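{- Let $p$ be a prime and $w\ge1$. A vector $c=(c_0,\ldots,c_{p-1})\in\mathbb Z^p$ with $\sum_j c_j=0$ is a coancestor if and only if $c_{j-1}-c_j\le w-1$ for all $1\le j\le p-1$ and $c_{p-1}-c_0\le w-2$.
   Context: Let $\mathscr C_p=\{(c_0,\ldots,c_{p-1})\in\mathbb Z^p:\sum c_j=0\}$. For $1\le j\le p-1$, $c\in\mathscr C_p$ is $j$-allowed if $c_j-c_{j-1}\ge w$, and then $\mathrm{sc}_j(c)$ is $c$ with coordinates $c_{j-1}$ and $c_j$ interchanged. $c$ is $0$-allowed if $c_0-c_{p-1}>w$, and then $\mathrm{sc}_0(c)=(c_{p-1}+1,c_1,\ldots,c_{p-2},c_0-1)$. A vector $c\in\mathscr C_p$ is a coancestor if there is no $0\le j\le p-1$ and no $j$-allowed $c'\in\mathscr C_p$ with $\mathrm{sc}_j(c')=c$. -}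

module Defs where

open import Data.Nat using (ℕ; zero; suc)
open import Data.Fin using (Fin; zero; suc; inject₁; fromℕ; _≟_)
open import Data.Integer using (ℤ; _+_; _-_; _≤_; _<_; +_; 0ℤ)
open import Data.Product using (Σ; _×_; ∃)
open import Data.Sum using (_⊎_)
open import Relation.Nullary using (¬_; yes; no)
open import Relation.Binary.PropositionalEquality using (_≡_)

Vecℤ : ℕ → Set
Vecℤ p = Fin p → ℤ

sumℤ : ∀ {n} → Vecℤ n → ℤ
sumℤ {zero}  c = 0ℤ
sumℤ {suc n} c = c zero + sumℤ (λ i → c (suc i))

inC : ∀ {p} → Vecℤ p → Set
inC c = sumℤ c ≡ 0ℤ

lastI : ∀ n → Fin (suc n)
lastI n = fromℕ n

swapIdx : ∀ {p} → Fin p → Fin p → Fin p → Fin p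
swapIdx a b i with i ≟ a
... | yes _ = b
... | no _ with i ≟ b
...   | yes _ = a
...   | no _  = i

-- For k : Fin n, the index j = suc k ranges over 1 ≤ j ≤ p-1 (p = suc n);
-- its predecessor j-1 is inject₁ k.

allowedS : ∀ {n} (w : ℤ) (k : Fin n) → Vecℤ (suc n) → Set
allowedS w k c = w ≤ c (suc k) - c (inject₁ k)

scS : ∀ {n} (k : Fin n) → Vecℤ (suc n) → Vecℤ (suc n)
scS k c i = c (swapIdx (inject₁ k) (suc k) i)

allowed0 : ∀ {n} (w : ℤ) → Vecℤ (suc n) → Set
allowed0 {n} w c = w < c zero - c (lastI n)

sc0 : ∀ {n} → Vecℤ (suc n) → Vecℤ (suc n)
sc0 {n} c i with i ≟ zero
... | yes _ = c (lastI n) + + 1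
... | no _ with i ≟ lastI n
...   | yes _ = c zero - + 1
...   | no _  = c i

IsCoancestor : ∀ {n} (w : ℤ) → Vecℤ (suc n) → Set
IsCoancestor {n} w c =
  (¬ Σ (Vecℤ (suc n)) λ c' → inC c' × allowed0 w c' × (∀ i → sc0 c' i ≡ c i))
  × (∀ (k : Fin n) → ¬ Σ (Vecℤ (suc n)) λ c' → inC c' × allowedS w k c' × (∀ i → scS k c' i ≡ c i))

-- Each of sc_1, …, sc_{p-1}, sc_0 is an involution of 𝒞_p (sc_0 only for
-- p ≥ 2, which primality guarantees). Hence c has a preimage under sc_j
-- exactly when sc_j(c) itself is j-allowed, and unfolding sc_j(c) turns
-- these allowedness conditions into c_{j-1} - c_j ≥ w and
-- c_{p-1} - c_0 > w - 2; a coancestor is a vector satisfying neither.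
module Submission where

open import Defs
open import Data.Nat using (ℕ; suc; zero)
open import Data.Nat.Primality using (Prime; ¬prime[1])
open import Data.Fin using (Fin; zero; suc; inject₁)
open import Data.Fin.Properties using (_≟_; suc-injective; <⇒≢; ≤̄⇒inject₁<)
import Data.Nat.Properties as ℕ
open import Data.Integer using (ℤ; _-_; _≤_; _<_; _+_; +_; 0ℤ; -_)
open import Data.Integer.Properties
  using (+-assoc; +-comm; +-identityʳ; +-inverseʳ; +-monoˡ-≤;
         ≰⇒>; <⇒≱; ≮⇒≥; ≤⇒≯; i<j⇒suc[i]≤j; suc[i]≤j⇒i<j)
open import Data.Integer.Tactic.RingSolver using (solve-∀)
open import Data.Vec.Functional using (updateAt)
open import Data.Vec.Functional.Properties using (updateAt-updates; updateAt-minimal)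
open import Data.Product using (Σ; _×_; _,_)
open import Function.Base using (_∘_)
open import Function.Bundles using (_⇔_; mk⇔; Equivalence)
open import Function.Construct.Composition using (_⇔-∘_)
open import Function.Related.TypeIsomorphisms using (¬-cong-⇔)
open import Relation.Nullary using (¬_; Dec; yes; no; contradiction)
open import Relation.Binary.PropositionalEquality
open ≡-Reasoning

private
  variable
    n : ℕ
    w : ℤ

i+k≤j⇔i≤j-k : ∀ {i j} k → i + k ≤ j ⇔ i ≤ j - k
i+k≤j⇔i≤j-k {i} {j} k = mk⇔
  (λ i+k≤j → subst (_≤ j - k) (+k-k i k) (+-monoˡ-≤ (- k) i+k≤j))
  (λ i≤j-k → subst (i + k ≤_) (-k+k j k) (+-monoˡ-≤ k i≤j-k))
  where
  +k-k : ∀ x y → (x + y) - y ≡ x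
  +k-k = solve-∀
  -k+k : ∀ x y → (x - y) + y ≡ x
  -k+k = solve-∀

≰⇔≤-1 : ∀ {i j} → (¬ j ≤ i) ⇔ i ≤ j - + 1
≰⇔≤-1 {i} {j} = i+k≤j⇔i≤j-k (+ 1) ⇔-∘ mk⇔
  (λ j≰i → subst (_≤ j) (+-comm (+ 1) i) (i<j⇒suc[i]≤j (≰⇒> j≰i)))
  (λ i+1≤j → <⇒≱ (suc[i]≤j⇒i<j (subst (_≤ j) (+-comm i (+ 1)) i+1≤j)))

≮+⇔≤- : ∀ {i j} k → (¬ j < i + k) ⇔ i ≤ j - k
≮+⇔≤- k = i+k≤j⇔i≤j-k k ⇔-∘ mk⇔ ≮⇒≥ ≤⇒≯

swapIdx-left : ∀ (a b : Fin n) → swapIdx a b a ≡ b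
swapIdx-left a b with a ≟ a
... | yes _  = refl
... | no a≢a = contradiction refl a≢a

swapIdx-right : ∀ (a b : Fin n) → swapIdx a b b ≡ a
swapIdx-right a b with b ≟ a
... | yes b≡a = b≡a
... | no _ with b ≟ b
...   | yes _  = refl
...   | no b≢b = contradiction refl b≢b

swapIdx-other : ∀ (a b : Fin n) {i} → i ≢ a → i ≢ b → swapIdx a b i ≡ i
swapIdx-other a b {i} i≢a i≢b with i ≟ a
... | yes i≡a = contradiction i≡a i≢a
... | no _ with i ≟ b
...   | yes i≡b = contradiction i≡b i≢b
...   | no _    = refl

swapIdx-involutive : ∀ (a b i : Fin n) → swapIdx a b (swapIdx a b i) ≡ i
swapIdx-involutive a b i with i ≟ a
... | yes refl = swapIdx-right a b
... | no i≢a with i ≟ b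
...   | yes refl = swapIdx-left a b
...   | no i≢b   = swapIdx-other a b i≢a i≢b

inject₁≢suc : (k : Fin n) → inject₁ k ≢ suc k
inject₁≢suc k = <⇒≢ (≤̄⇒inject₁< ℕ.≤-refl)

sumℤ-cong : {f g : Vecℤ n} → (∀ i → f i ≡ g i) → sumℤ f ≡ sumℤ g
sumℤ-cong {zero}  f≗g = refl
sumℤ-cong {suc n} f≗g = cong₂ _+_ (f≗g zero) (sumℤ-cong (λ i → f≗g (suc i)))

sumℤ-agree-off : (j : Fin n) {f g : Vecℤ n} → (∀ i → i ≢ j → f i ≡ g i) →
                 sumℤ f ≡ sumℤ g + (f j - g j)
sumℤ-agree-off zero {f} {g} agree = begin
  f zero + sumℤ (λ i → f (suc i)) ≡⟨ cong (_+_ (f zero)) (sumℤ-cong (λ i → agree (suc i) λ ())) ⟩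
  f zero + sumℤ (λ i → g (suc i)) ≡⟨ shuffle (f zero) (g zero) _ ⟩
  (g zero + sumℤ (λ i → g (suc i))) + (f zero - g zero) ∎
  where
  shuffle : ∀ x y s → x + s ≡ (y + s) + (x - y)
  shuffle = solve-∀
sumℤ-agree-off (suc j) {f} {g} agree = begin
  f zero + sumℤ (λ i → f (suc i))
    ≡⟨ cong₂ _+_ (agree zero λ ()) (sumℤ-agree-off j (λ i i≢j → agree (suc i) (i≢j ∘ suc-injective))) ⟩
  g zero + (sumℤ (λ i → g (suc i)) + (f (suc j) - g (suc j)))
    ≡⟨ +-assoc (g zero) _ _ ⟨
  (g zero + sumℤ (λ i → g (suc i))) + (f (suc j) - g (suc j)) ∎

sumℤ-agree-off₂ : {a b : Fin n} {f g : Vecℤ n} → a ≢ b →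
                  (∀ i → i ≢ a → i ≢ b → f i ≡ g i) →
                  sumℤ f ≡ sumℤ g + ((f a - g a) + (f b - g b))
sumℤ-agree-off₂ {n = n} {a = a} {b} {f} {g} a≢b agree = begin
  sumℤ f                                   ≡⟨ sumℤ-agree-off b (λ i i≢b → sym (updateAt-minimal i b f i≢b)) ⟩
  sumℤ h + (f b - h b)                     ≡⟨ cong₂ (λ s x → s + (f b - x)) (sumℤ-agree-off a h-agree) (updateAt-updates b f) ⟩
  (sumℤ g + (h a - g a)) + (f b - g b)     ≡⟨ cong (λ x → (sumℤ g + (x - g a)) + (f b - g b)) (updateAt-minimal a b f a≢b) ⟩
  (sumℤ g + (f a - g a)) + (f b - g b)     ≡⟨ +-assoc (sumℤ g) _ _ ⟩
  sumℤ g + ((f a - g a) + (f b - g b))     ∎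
  where
  h : Vecℤ n
  h = updateAt f b (λ _ → g b)
  h-agree : ∀ i → i ≢ a → h i ≡ g i
  h-agree i i≢a with i ≟ b
  ... | yes refl = updateAt-updates b f
  ... | no i≢b   = trans (updateAt-minimal i b f i≢b) (agree i i≢a i≢b)

sumℤ-exchange : {a b : Fin n} {f g : Vecℤ n} → a ≢ b →
                (∀ i → i ≢ a → i ≢ b → f i ≡ g i) →
                f a + f b ≡ g a + g b → sumℤ f ≡ sumℤ g
sumℤ-exchange {a = a} {b} {f} {g} a≢b agree same-total = begin
  sumℤ f                               ≡⟨ sumℤ-agree-off₂ a≢b agree ⟩
  sumℤ g + ((f a - g a) + (f b - g b)) ≡⟨ cong (_+_ (sumℤ g)) (regroup (f a) (f b) (g a) (g b)) ⟩
  sumℤ g + ((f a + f b) - (g a + g b)) ≡⟨ cong (λ x → sumℤ g + (x - (g a + g b))) same-total ⟩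
  sumℤ g + ((g a + g b) - (g a + g b)) ≡⟨ cong (_+_ (sumℤ g)) (+-inverseʳ (g a + g b)) ⟩
  sumℤ g + 0ℤ                          ≡⟨ +-identityʳ (sumℤ g) ⟩
  sumℤ g                               ∎
  where
  regroup : ∀ x y u v → (x - u) + (y - v) ≡ (x + y) - (u + v)
  regroup = solve-∀

module _ (k : Fin n) (c : Vecℤ (suc n)) where

  scS-inject₁ : scS k c (inject₁ k) ≡ c (suc k)
  scS-inject₁ = cong c (swapIdx-left (inject₁ k) (suc k))

  scS-suc : scS k c (suc k) ≡ c (inject₁ k)
  scS-suc = cong c (swapIdx-right (inject₁ k) (suc k))

  scS-involutive : ∀ i → scS k (scS k c) i ≡ c i
  scS-involutive i = cong c (swapIdx-involutive (inject₁ k) (suc k) i)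

  sumℤ-scS : sumℤ (scS k c) ≡ sumℤ c
  sumℤ-scS = sumℤ-exchange (inject₁≢suc k)
    (λ i i≢k i≢k+1 → cong c (swapIdx-other (inject₁ k) (suc k) i≢k i≢k+1))
    (trans (cong₂ _+_ scS-inject₁ scS-suc) (+-comm (c (suc k)) (c (inject₁ k))))

HasPreimageS : ℤ → Fin n → Vecℤ (suc n) → Set
HasPreimageS {n} w k c =
  Σ (Vecℤ (suc n)) λ c' → inC c' × allowedS w k c' × (∀ i → scS k c' i ≡ c i)

scS-preimage⇔ : (k : Fin n) {c : Vecℤ (suc n)} → inC c →
                HasPreimageS w k c ⇔ w ≤ c (inject₁ k) - c (suc k)
scS-preimage⇔ {w = w} k {c} c∈𝒞 = mk⇔
  (λ (c' , _ , allowed , sc[c']≗c) → subst (w ≤_) (swapped-gap c' sc[c']≗c) allowed)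
  (λ w≤gap → scS k c , trans (sumℤ-scS k c) c∈𝒞 ,
             subst (w ≤_) (sym (swapped-gap (scS k c) (scS-involutive k c))) w≤gap ,
             scS-involutive k c)
  where
  swapped-gap : ∀ c' → (∀ i → scS k c' i ≡ c i) →
                c' (suc k) - c' (inject₁ k) ≡ c (inject₁ k) - c (suc k)
  swapped-gap c' sc[c']≗c = cong₂ _-_
    (trans (sym (scS-inject₁ k c')) (sc[c']≗c (inject₁ k)))
    (trans (sym (scS-suc k c')) (sc[c']≗c (suc k)))

module _ (c : Vecℤ (suc (suc n))) where

  sc0-last : sc0 c (lastI (suc n)) ≡ c zero - + 1
  sc0-last with lastI (suc n) ≟ lastI (suc n)
  ... | yes _  = refl
  ... | no l≢l = contradiction refl l≢l

  sc0-other : ∀ {i} → i ≢ zero → i ≢ lastI (suc n) → sc0 c i ≡ c i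
  sc0-other {i} i≢0 i≢l with i ≟ zero
  ... | yes i≡0 = contradiction i≡0 i≢0
  ... | no _ with i ≟ lastI (suc n)
  ...   | yes i≡l = contradiction i≡l i≢l
  ...   | no _    = refl

  sumℤ-sc0 : sumℤ (sc0 c) ≡ sumℤ c
  sumℤ-sc0 = sumℤ-exchange (λ ()) (λ i → sc0-other)
    (trans (cong (_+_ (c (lastI (suc n)) + + 1)) sc0-last)
           (shuffle (c (lastI (suc n))) (c zero)))
    where
    shuffle : ∀ x y → (x + + 1) + (y - + 1) ≡ y + x
    shuffle = solve-∀

sc0-involutive : (c : Vecℤ (suc (suc n))) → ∀ i → sc0 (sc0 c) i ≡ c i
sc0-involutive {n} c i = by-cases (i ≟ zero) (i ≟ lastI (suc n))
  where
  -1+1 : ∀ x → (x - + 1) + + 1 ≡ x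
  -1+1 = solve-∀
  +1-1 : ∀ x → (x + + 1) - + 1 ≡ x
  +1-1 = solve-∀
  by-cases : Dec (i ≡ zero) → Dec (i ≡ lastI (suc n)) → sc0 (sc0 c) i ≡ c i
  by-cases (yes refl) _          = trans (cong (_+ + 1) (sc0-last c)) (-1+1 (c zero))
  by-cases (no _)     (yes refl) = trans (sc0-last (sc0 c)) (+1-1 (c (lastI (suc n))))
  by-cases (no i≢0)   (no i≢l)   = trans (sc0-other (sc0 c) i≢0 i≢l) (sc0-other c i≢0 i≢l)

HasPreimage0 : ℤ → Vecℤ (suc n) → Set
HasPreimage0 {n} w c =
  Σ (Vecℤ (suc n)) λ c' → inC c' × allowed0 w c' × (∀ i → sc0 c' i ≡ c i)

sc0-preimage⇔ : {c : Vecℤ (suc (suc n))} → inC c →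
                HasPreimage0 w c ⇔ w < (c (lastI (suc n)) - c zero) + + 2
sc0-preimage⇔ {n} {w} {c} c∈𝒞 = mk⇔
  (λ (c' , _ , allowed , sc0[c']≗c) → subst (w <_) (sym (shifted-gap c' sc0[c']≗c)) allowed)
  (λ w<gap+2 → sc0 c , trans (sumℤ-sc0 c) c∈𝒞 ,
               subst (w <_) (shifted-gap (sc0 c) (sc0-involutive c)) w<gap+2 ,
               sc0-involutive c)
  where
  l = lastI (suc n)
  shifted-gap : ∀ c' → (∀ i → sc0 c' i ≡ c i) → (c l - c zero) + + 2 ≡ c' zero - c' l
  shifted-gap c' sc0[c']≗c = begin
    (c l - c zero) + + 2                  ≡⟨ cong₂ (λ x y → (x - y) + + 2) (sym (sc0[c']≗c l)) (sym (sc0[c']≗c zero)) ⟩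
    (sc0 c' l - (c' l + + 1)) + + 2       ≡⟨ cong (λ x → (x - (c' l + + 1)) + + 2) (sc0-last c') ⟩
    ((c' zero - + 1) - (c' l + + 1)) + + 2 ≡⟨ cancel (c' zero) (c' l) ⟩
    c' zero - c' l                        ∎
    where
    cancel : ∀ x y → ((x - + 1) - (y + + 1)) + + 2 ≡ x - y
    cancel = solve-∀

lemma4p14 : (n : ℕ) → Prime (suc n) → (w : ℕ) → 1 Data.Nat.≤ w →
    (c : Vecℤ (suc n)) → inC c →
    IsCoancestor (+ w) c ⇔
      ((∀ (k : Fin n) → c (inject₁ k) - c (suc k) ≤ + w - + 1)
       × c (lastI n) - c zero ≤ + w - + 2)
lemma4p14 zero    p-prime = contradiction p-prime ¬prime[1]
lemma4p14 (suc m) _ w _ c c∈𝒞 = mk⇔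
  (λ (no-sc0 , no-scS) → (λ k → to (coancestorS k) (no-scS k)) , to coancestor0 no-sc0)
  (λ (gapsS , gap0) → from coancestor0 gap0 , λ k → from (coancestorS k) (gapsS k))
  where
  open Equivalence
  coancestorS : (k : Fin (suc m)) →
                (¬ HasPreimageS (+ w) k c) ⇔ c (inject₁ k) - c (suc k) ≤ + w - + 1
  coancestorS k = ≰⇔≤-1 ⇔-∘ ¬-cong-⇔ (scS-preimage⇔ k c∈𝒞)
  coancestor0 : (¬ HasPreimage0 (+ w) c) ⇔ c (lastI (suc m)) - c zero ≤ + w - + 2
  coancestor0 = ≮+⇔≤- (+ 2) ⇔-∘ ¬-cong-⇔ (sc0-preimage⇔ c∈𝒞)
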